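{- Let $f(z)=z^d+z^e+c\in\mathbb{Q}[z]$ with integers $d>e\ge2$ and $c\in\mathbb{Q}$ with $-2<c<-1$, and suppose that $d$ is odd or $e$ is even. Then $\mathcal{Z}(f,0)=\emptyset$.
   Context: Write $f^n(0)=A_n/B_n$ in lowest terms with $B_n>0$, where $f^n$ is the $n$-th iterate of $f$. A prime $p$ is a primitive prime divisor of $A_n$ if $p\mid A_n$ but $p\nmid A_m$ for all $1\le m<n$. $\mathcal{Z}(f,0)=\{n\ge1: A_n\text{ has no primitive prime divisor}\}$. -}

module Defs where

open import Data.Nat using (ℕ; zero; suc; _<_; _≤_)
open import Data.Nat.Divisibility using (_∣_)
open import Data.Nat.Primality using (Prime)
open import Data.Integer using (∣_∣)
open import Data.Rational using (ℚ; ↥_; _+_; _*_; 0ℚ; 1ℚ)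
open import Data.Product using (Σ; _×_)
open import Relation.Nullary using (¬_)

_^ᵠ_ : ℚ → ℕ → ℚ
x ^ᵠ zero  = 1ℚ
x ^ᵠ suc k = x * (x ^ᵠ k)

poly : ℕ → ℕ → ℚ → ℚ → ℚ
poly d e c z = (z ^ᵠ d) + (z ^ᵠ e) + c

iter : (ℚ → ℚ) → ℕ → ℚ → ℚ
iter f zero    x = x
iter f (suc n) x = f (iter f n x)

-- A_n : numerator of f^n(0) in lowest terms (ℚ is always normalised,
-- with positive denominator), as a natural number via absolute value
-- (divisibility by a prime is insensitive to sign)
A : (ℚ → ℚ) → ℕ → ℕ
A f n = ∣ ↥ (iter f n 0ℚ) ∣

PrimitivePrimeDivisor : (ℚ → ℚ) → ℕ → ℕ → Set
PrimitivePrimeDivisor f n p =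
  Prime p × (p ∣ A f n) × (∀ m → 1 ≤ m → m < n → ¬ (p ∣ A f m))

InZ : (ℚ → ℚ) → ℕ → Set
InZ f n = (1 ≤ n) × (∀ p → ¬ PrimitivePrimeDivisor f n p)

module Submission where

-- Write c = - s / b in lowest terms, so b < s.  Then f^(i+1)(0) = Z i / b ^ (d ^ i), where Z 0 = - s,
--   Z (i+1) = Z i ^ d + Z i ^ e · b ^ (d ^ i · (d - e)) - s · b ^ (d ^ (i+1) - 1),
-- and every Z i is coprime to b, so A (i+1) = ∣Z i∣.
-- Rigid divisibility: Z m ² divides Z (m+1+k) - b ^ t · Z k, so a prime that first divides Z m
-- divides no Z n to a higher power than it divides Z m.
-- Growth: by induction ∣f^(i+1)(0)∣ ≥ s / b.  As d is odd or e is even, Z i ^ d > 0 > Z i ^ e never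
-- happens, so with u = ∣Z i∣ and P, Q the powers of b above, ∣Z (i+1)∣ ≥ u ^ d - u ^ e P + s Q > u ².
-- So if Z i had no new prime factor, each of its prime powers would divide an earlier term, and
-- ∣Z i∣ would divide ∏_{m<i} ∣Z m∣ < ∣Z i∣.

open import Defs
open import Data.Nat using (ℕ)
import Data.Nat as ℕ
import Data.Nat.Properties as ℕ
import Data.Nat.Divisibility as ℕ
open import Data.Integer using (ℤ)
open import Data.Rational using (ℚ)
open import Relation.Nullary using (¬_)
open import Data.Sum using (_⊎_)
open import Relation.Binary.PropositionalEquality using (_≡_)

module Divisibility where

  open import Data.Nat using (ℕ; zero; suc; _*_; _^_; _≤_; _<_; s≤s; z≤n; NonZero)
  open import Data.Nat.Properties
  open import Data.Nat.Divisibility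
  open import Data.Nat.Coprimality as Coprime using (Coprime; coprime-divisor)
  open import Data.Nat.Primality using (Prime; prime⇒irreducible; prime⇒nonZero; prime⇒nonTrivial; ¬prime[1])
  open import Data.Nat.Primality.Factorisation using (factorise)
  open import Data.Nat.ListAction using (product)
  open import Data.List using ([]; _∷_)
  open import Data.List.Relation.Unary.All using (_∷_)
  open import Data.Product using (∃-syntax; _×_; _,_)
  open import Data.Sum using (inj₁; inj₂)
  open import Induction.WellFounded using (Acc; acc)
  open import Data.Nat.Induction using (<-wellFounded)
  open import Relation.Nullary using (¬_; yes; no; contradiction)
  open import Function using (_∘_)
  open import Relation.Binary.PropositionalEquality

  private variable m n o p q : ℕ

  ∣⇒coprimeˡ : m ∣ n → Coprime n o → Coprime m o
  ∣⇒coprimeˡ m∣n n⊥o (i∣m , i∣o) = n⊥o (∣-trans i∣m m∣n , i∣o)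

  coprime-*ˡ : Coprime m o → Coprime n o → Coprime (m * n) o
  coprime-*ˡ {m = m} m⊥o n⊥o {i} (i∣mn , i∣o) = n⊥o (coprime-divisor i⊥m i∣mn , i∣o)
    where
    i⊥m : Coprime i m
    i⊥m (j∣i , j∣m) = m⊥o (j∣m , ∣-trans j∣i i∣o)

  coprime-^ˡ : ∀ k → Coprime m n → Coprime (m ^ k) n
  coprime-^ˡ zero    m⊥n (i∣1 , _) = ∣1⇒≡1 i∣1
  coprime-^ˡ (suc k) m⊥n = coprime-*ˡ m⊥n (coprime-^ˡ k m⊥n)

  coprime-^ʳ : ∀ k → Coprime m n → Coprime m (n ^ k)
  coprime-^ʳ k m⊥n = Coprime.sym (coprime-^ˡ k (Coprime.sym m⊥n))

  prime∤⇒coprime : Prime p → ¬ p ∣ n → Coprime p n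
  prime∤⇒coprime pp p∤n (i∣p , i∣n) with prime⇒irreducible pp i∣p
  ... | inj₁ i≡1 = i≡1
  ... | inj₂ refl = contradiction i∣n p∤n

  prime∣prime⇒≡ : Prime q → Prime p → q ∣ p → q ≡ p
  prime∣prime⇒≡ qp pp q∣p with prime⇒irreducible pp q∣p
  ... | inj₁ refl = contradiction qp ¬prime[1]
  ... | inj₂ q≡p = q≡p

  prime-divisor : 2 ≤ n → ∃[ p ] Prime p × p ∣ n
  prime-divisor {n = suc n} 2≤n with factorise (suc n)
  ... | record { factors = [] ; isFactorisation = n≡1 } = contradiction (sym n≡1) (<⇒≢ 2≤n)
  ... | record { factors = p ∷ ps ; isFactorisation = n≡p*ps ; factorsPrime = pp ∷ _ } =
    p , pp , divides (product ps) (trans n≡p*ps (*-comm p (product ps)))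

  prime-powers-∣-cancelʳ : ∀ {r} → Prime p →
                           (∀ {q} k → Prime q → q ^ k ∣ r * p → q ^ k ∣ m * p) →
                           (∀ {q} k → Prime q → q ^ k ∣ r → q ^ k ∣ m)
  prime-powers-∣-cancelʳ {p} {m} {r} pp h {q} k qp qᵏ∣r with q ≟ p
  ... | yes refl = *-cancelʳ-∣ q {{prime⇒nonZero pp}}
                     (subst (_∣ m * q) (*-comm q (q ^ k)) (h (suc k) qp (subst (_∣ r * q) (*-comm (q ^ k) q) (*-monoˡ-∣ q qᵏ∣r))))
  ... | no q≢p = coprime-divisor (coprime-^ˡ k (prime∤⇒coprime qp (q≢p ∘ prime∣prime⇒≡ qp pp)))
                   (subst (q ^ k ∣_) (*-comm m p) (h k qp (∣m⇒∣m*n p qᵏ∣r)))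

  ∣-by-prime-powers : .{{NonZero n}} → (∀ {p} k → Prime p → p ^ k ∣ n → p ^ k ∣ m) → n ∣ m
  ∣-by-prime-powers {n} {m} = go n (<-wellFounded n) m
    where
    go : ∀ n → Acc _<_ n → .{{NonZero n}} → ∀ m → (∀ {p} k → Prime p → p ^ k ∣ n → p ^ k ∣ m) → n ∣ m
    go 1 _ m _ = 1∣ m
    go n@(suc (suc _)) (acc rec) m h with prime-divisor {n} (s≤s (s≤s z≤n))
    ... | p , pp , p∣n with p∣n | h 1 pp (subst (_∣ n) (sym (^-identityʳ p)) p∣n)
    ...   | divides r@(suc _) n≡r*p | p¹∣m with subst (_∣ m) (^-identityʳ p) p¹∣m
    ...     | divides m′ m≡m′*p = subst₂ _∣_ (sym n≡r*p) (sym m≡m′*p) (*-monoˡ-∣ p r∣m′)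
      where
      r<n : r < n
      r<n = quotient-< (divides r n≡r*p) {{prime⇒nonTrivial pp}}
      r∣m′ : r ∣ m′
      r∣m′ = go r (rec r<n) m′ (prime-powers-∣-cancelʳ pp λ {q} k qp qᵏ∣r*p →
        subst (q ^ k ∣_) m≡m′*p (h k qp (subst (q ^ k ∣_) (sym n≡r*p) qᵏ∣r*p)))

module IntegerPowers where

  open import Data.Nat as ℕ using (ℕ; zero; suc; z≤n; s≤s)
  import Data.Nat.Properties as ℕ
  import Data.Nat.Divisibility as ℕ
  open import Data.Integer using (ℤ; +_; -[1+_]; ∣_∣; _+_; _*_; _-_; -_; _^_; _≤_; -≤+; +≤+; 0ℤ; 1ℤ; -1ℤ)
  open import Data.Integer.Properties
  open import Data.Integer.Divisibility.Signed
  open import Data.Integer.Tactic.RingSolver using (solve-∀)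
  open import Data.Product using (∃-syntax; _×_; _,_)
  open import Data.Sum using (_⊎_; inj₁; inj₂)
  open import Relation.Nullary using (¬_; yes; no; contradiction)
  open import Relation.Binary.PropositionalEquality

  open ≡-Reasoning

  ^-distribʳ-* : ∀ x y n → (x * y) ^ n ≡ x ^ n * y ^ n
  ^-distribʳ-* x y zero    = refl
  ^-distribʳ-* x y (suc n) = begin
    x * y * (x * y) ^ n     ≡⟨ cong (x * y *_) (^-distribʳ-* x y n) ⟩
    x * y * (x ^ n * y ^ n) ≡⟨ interchange x y (x ^ n) (y ^ n) ⟩
    x * x ^ n * (y * y ^ n) ∎
    where
    interchange : ∀ a b c d → a * b * (c * d) ≡ a * c * (b * d)
    interchange = solve-∀

  pos-^ : ∀ m n → (+ m) ^ n ≡ + (m ℕ.^ n)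
  pos-^ m zero    = refl
  pos-^ m (suc n) = trans (cong (+ m *_) (pos-^ m n)) (sym (pos-* m (m ℕ.^ n)))

  abs-^ : ∀ x n → ∣ x ^ n ∣ ≡ ∣ x ∣ ℕ.^ n
  abs-^ x zero    = refl
  abs-^ x (suc n) = trans (abs-* x (x ^ n)) (cong (∣ x ∣ ℕ.*_) (abs-^ x n))

  0^n≡0 : ∀ n → 1 ℕ.≤ n → 0ℤ ^ n ≡ 0ℤ
  0^n≡0 (suc n) _ = *-zeroˡ (0ℤ ^ n)

  -1^[q*2]≡1 : ∀ q → -1ℤ ^ (q ℕ.* 2) ≡ 1ℤ
  -1^[q*2]≡1 zero    = refl
  -1^[q*2]≡1 (suc q) = cong (λ z → -1ℤ * (-1ℤ * z)) (-1^[q*2]≡1 q)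

  neg-^-even : ∀ x q → (- x) ^ (q ℕ.* 2) ≡ x ^ (q ℕ.* 2)
  neg-^-even x q = begin
    (- x) ^ (q ℕ.* 2)             ≡⟨ cong (_^ (q ℕ.* 2)) (sym (-1*i≡-i x)) ⟩
    (-1ℤ * x) ^ (q ℕ.* 2)         ≡⟨ ^-distribʳ-* -1ℤ x (q ℕ.* 2) ⟩
    -1ℤ ^ (q ℕ.* 2) * x ^ (q ℕ.* 2) ≡⟨ cong (_* x ^ (q ℕ.* 2)) (-1^[q*2]≡1 q) ⟩
    1ℤ * x ^ (q ℕ.* 2)            ≡⟨ *-identityˡ _ ⟩
    x ^ (q ℕ.* 2)                 ∎

  neg-^-odd : ∀ x q → (- x) ^ suc (q ℕ.* 2) ≡ - x ^ suc (q ℕ.* 2)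
  neg-^-odd x q = trans (cong (- x *_) (neg-^-even x q)) (sym (neg-distribˡ-* x (x ^ (q ℕ.* 2))))

  even-or-odd : ∀ n → ∃[ q ] (n ≡ q ℕ.* 2 ⊎ n ≡ suc (q ℕ.* 2))
  even-or-odd zero = 0 , inj₁ refl
  even-or-odd (suc n) with even-or-odd n
  ... | q , inj₁ n≡2q  = q , inj₂ (cong suc n≡2q)
  ... | q , inj₂ n≡2q+1 = suc q , inj₁ (cong suc n≡2q+1)

  ^-even : ∀ {n} → 2 ℕ.∣ n → ∀ x → x ^ n ≡ + (∣ x ∣ ℕ.^ n)
  ^-even {n} _                  (+ m)    = pos-^ m n
  ^-even (ℕ.divides q refl) -[1+ m ] = trans (neg-^-even (+ suc m) q) (pos-^ (suc m) (q ℕ.* 2))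

  ^-odd-neg : ∀ {n} → ¬ 2 ℕ.∣ n → ∀ m → (- + m) ^ n ≡ - + (m ℕ.^ n)
  ^-odd-neg {n} 2∤n m with even-or-odd n
  ... | q , inj₁ n≡2q = contradiction (ℕ.divides q n≡2q) 2∤n
  ... | q , inj₂ refl = trans (neg-^-odd (+ m) q) (cong -_ (pos-^ m (suc (q ℕ.* 2))))

  ^-cong-∣ : ∀ {m x y} n → m ∣ x - y → m ∣ x ^ n - y ^ n
  ^-cong-∣ {m} zero _ = divides 0ℤ (sym (*-zeroˡ m))
  ^-cong-∣ {m} {x} {y} (suc n) m∣x-y = subst (m ∣_) (sym (split x y (x ^ n) (y ^ n)))
    (∣m∣n⇒∣m+n (∣n⇒∣m*n x (^-cong-∣ n m∣x-y)) (∣n⇒∣m*n (y ^ n) m∣x-y))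
    where
    split : ∀ x y u v → x * u - y * v ≡ x * (u - v) + v * (x - y)
    split = solve-∀

  x*x∣x^n : ∀ x {n} → 2 ℕ.≤ n → x * x ∣ x ^ n
  x*x∣x^n x {suc (suc n)} (s≤s (s≤s z≤n)) = subst (x * x ∣_) (*-assoc x x (x ^ n)) (∣m⇒∣m*n (x ^ n) ∣-refl)

  ^-sign-pattern : ∀ {m n} → (¬ 2 ℕ.∣ m) ⊎ (2 ℕ.∣ n) → ∀ x →
                   (x ^ m ≡ + (∣ x ∣ ℕ.^ m) × x ^ n ≡ + (∣ x ∣ ℕ.^ n)) ⊎ x ^ m ≡ - + (∣ x ∣ ℕ.^ m)
  ^-sign-pattern {m} {n} _ (+ k) = inj₁ (pos-^ k m , pos-^ k n)
  ^-sign-pattern {m} {n} parity -[1+ k ] with 2 ℕ.∣? m | parity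
  ... | no 2∤m  | _         = inj₂ (^-odd-neg 2∤m (suc k))
  ... | yes 2∣m | inj₁ 2∤m  = contradiction 2∣m 2∤m
  ... | yes 2∣m | inj₂ 2∣n  = inj₁ (^-even 2∣m -[1+ k ] , ^-even 2∣n -[1+ k ])

  +m-+n≡+[m∸n] : ∀ {m n} → n ℕ.≤ m → + m - + n ≡ + (m ℕ.∸ n)
  +m-+n≡+[m∸n] {m} {n} n≤m = trans (m-n≡m⊖n m n) (⊖-≥ n≤m)

  i≤+∣i∣ : ∀ i → i ≤ + ∣ i ∣
  i≤+∣i∣ (+ n)    = ≤-refl
  i≤+∣i∣ -[1+ n ] = -≤+

  +n≤i⇒n≤∣i∣ : ∀ {n i} → + n ≤ i → n ℕ.≤ ∣ i ∣
  +n≤i⇒n≤∣i∣ (+≤+ n≤m) = n≤m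

module NumeratorSequence (d e b : ℕ) (a : ℤ) (2≤e : 2 ℕ.≤ e) (e<d : e ℕ.< d) where
  open import Data.Nat as ℕ using (ℕ; zero; suc; z≤n; s≤s)
  import Data.Nat.Properties as ℕ
  open import Data.Integer using (ℤ; +_; ∣_∣; _+_; _*_; _-_; -_; _^_; 0ℤ)
  open import Data.Integer.Properties
  open import Data.Integer.Divisibility.Signed
  open import Data.Integer.Tactic.RingSolver using (solve-∀)
  open import Data.Product using (∃-syntax; _,_)
  open import Relation.Binary.PropositionalEquality
  open import Data.Nat.Coprimality using (Coprime; coprime-divisor)
  import Data.Nat.Coprimality as Coprime
  import Data.Nat.Divisibility as ℕ
  open import Data.Nat.Induction using (<-wellFounded)
  open import Induction.WellFounded using (Acc; acc)
  open import Relation.Binary using (tri<; tri≈; tri>)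
  open import Relation.Nullary using (¬_; contradiction)
  open Divisibility
  open IntegerPowers
  open ≡-Reasoning


  e≤d : e ℕ.≤ d
  e≤d = ℕ.<⇒≤ e<d

  1≤e : 1 ℕ.≤ e
  1≤e = ℕ.≤-trans (s≤s z≤n) 2≤e

  1≤d : 1 ℕ.≤ d
  1≤d = ℕ.≤-trans 1≤e e≤d

  1≤dⁱ : ∀ i → 1 ℕ.≤ d ℕ.^ i
  1≤dⁱ = ℕ.m^n>0 d {{ℕ.>-nonZero 1≤d}}

  b^ : ℕ → ℤ
  b^ k = + (b ℕ.^ k)

  b^-+ : ∀ m n → b^ (m ℕ.+ n) ≡ b^ m * b^ n
  b^-+ m n = trans (cong +_ (ℕ.^-distribˡ-+-* b m n)) (pos-* (b ℕ.^ m) (b ℕ.^ n))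

  b^-^ : ∀ m n → b^ m ^ n ≡ b^ (m ℕ.* n)
  b^-^ m n = trans (pos-^ (b ℕ.^ m) n) (cong +_ (ℕ.^-*-assoc b m n))

  P Q : ℕ → ℕ
  P j = b ℕ.^ (j ℕ.* (d ℕ.∸ e))
  Q j = b ℕ.^ (j ℕ.* d ℕ.∸ 1)

  -- For c = a / b and j ≥ 1:  f (X / b ^ j) = step X j / b ^ (j * d).
  step : ℤ → ℕ → ℤ
  step X j = X ^ d + X ^ e * + P j + a * + Q j

  b^[je]*P≡b^[jd] : ∀ j → b ℕ.^ (j ℕ.* e) ℕ.* P j ≡ b ℕ.^ (j ℕ.* d)
  b^[je]*P≡b^[jd] j = trans (sym (ℕ.^-distribˡ-+-* b (j ℕ.* e) _))
    (cong (b ℕ.^_) (trans (sym (ℕ.*-distribˡ-+ j e (d ℕ.∸ e))) (cong (j ℕ.*_) (ℕ.m+[n∸m]≡n e≤d))))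

  b*Q≡b^[jd] : ∀ j → 1 ℕ.≤ j ℕ.* d → b ℕ.* Q j ≡ b ℕ.^ (j ℕ.* d)
  b*Q≡b^[jd] j 1≤jd = cong (b ℕ.^_) (ℕ.m+[n∸m]≡n 1≤jd)

  steps : ℕ → ℤ → ℕ → ℤ
  steps zero    X j = X
  steps (suc k) X j = steps k (step X j) (j ℕ.* d)

  Z : ℕ → ℤ
  Z i = steps i a 1

  steps-+ : ∀ m k X j → steps (m ℕ.+ k) X j ≡ steps k (steps m X j) (j ℕ.* d ℕ.^ m)
  steps-+ zero    k X j = cong (steps k X) (sym (ℕ.*-identityʳ j))
  steps-+ (suc m) k X j = trans (steps-+ m k (step X j) (j ℕ.* d))
    (cong (steps k (steps (suc m) X j)) (ℕ.*-assoc j d (d ℕ.^ m)))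

  Z-suc : ∀ i → Z (suc i) ≡ step (Z i) (d ℕ.^ i)
  Z-suc i = begin
    steps (suc i) a 1          ≡⟨ cong (λ n → steps n a 1) (ℕ.+-comm 1 i) ⟩
    steps (i ℕ.+ 1) a 1        ≡⟨ steps-+ i 1 a 1 ⟩
    step (Z i) (1 ℕ.* d ℕ.^ i) ≡⟨ cong (step (Z i)) (ℕ.*-identityˡ (d ℕ.^ i)) ⟩
    step (Z i) (d ℕ.^ i)       ∎

  step-cong-∣ : ∀ {m X Y} j → m ∣ X - Y → m ∣ step X j - step Y j
  step-cong-∣ {m} {X} {Y} j m∣X-Y = subst (m ∣_) (sym (regroup (X ^ d) (Y ^ d) (X ^ e) (Y ^ e) _ _))
    (∣m∣n⇒∣m+n (^-cong-∣ d m∣X-Y) (∣m⇒∣m*n _ (^-cong-∣ e m∣X-Y)))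
    where
    regroup : ∀ xd yd xe ye p q → (xd + xe * p + q) - (yd + ye * p + q) ≡ (xd - yd) + (xe - ye) * p
    regroup = solve-∀

  steps-cong-∣ : ∀ {m X Y} k j → m ∣ X - Y → m ∣ steps k X j - steps k Y j
  steps-cong-∣ zero    j m∣X-Y = m∣X-Y
  steps-cong-∣ (suc k) j m∣X-Y = steps-cong-∣ k (j ℕ.* d) (step-cong-∣ j m∣X-Y)

  step-scale : ∀ X j t → 1 ℕ.≤ j ℕ.* d → step (b^ t * X) (j ℕ.+ t) ≡ b^ (t ℕ.* d) * step X j
  step-scale X j t 1≤jd = begin
    (b^ t * X) ^ d + (b^ t * X) ^ e * + P (j ℕ.+ t) + a * + Q (j ℕ.+ t)
      ≡⟨ cong₂ _+_ (cong₂ _+_ (scale^ d) (cong₂ _*_ (scale^ e) P-split)) (cong (a *_) Q-split) ⟩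
    Td * X ^ d + Te * X ^ e * (+ P j * + P t) + a * (Td * + Q j)
      ≡⟨ regroup Td Te (+ P t) (X ^ d) (X ^ e) (+ P j) (+ Q j) a ⟩
    Td * X ^ d + (Te * + P t) * (X ^ e * + P j) + Td * (a * + Q j)
      ≡⟨ cong (λ z → Td * X ^ d + z * (X ^ e * + P j) + Td * (a * + Q j)) Te*Pt≡Td ⟩
    Td * X ^ d + Td * (X ^ e * + P j) + Td * (a * + Q j)
      ≡⟨ factor Td (X ^ d) (X ^ e * + P j) (a * + Q j) ⟩
    Td * step X j ∎
    where
    Td Te : ℤ
    Td = b^ (t ℕ.* d)
    Te = b^ (t ℕ.* e)
    scale^ : ∀ n → (b^ t * X) ^ n ≡ b^ (t ℕ.* n) * X ^ n
    scale^ n = trans (^-distribʳ-* (b^ t) X n) (cong (_* X ^ n) (b^-^ t n))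
    P-split : + P (j ℕ.+ t) ≡ + P j * + P t
    P-split = trans (cong b^ (ℕ.*-distribʳ-+ (d ℕ.∸ e) j t)) (b^-+ (j ℕ.* (d ℕ.∸ e)) (t ℕ.* (d ℕ.∸ e)))
    Q-split : + Q (j ℕ.+ t) ≡ Td * + Q j
    Q-split = trans (cong b^ exponent) (b^-+ (t ℕ.* d) (j ℕ.* d ℕ.∸ 1))
      where
      exponent : (j ℕ.+ t) ℕ.* d ℕ.∸ 1 ≡ t ℕ.* d ℕ.+ (j ℕ.* d ℕ.∸ 1)
      exponent = begin
        (j ℕ.+ t) ℕ.* d ℕ.∸ 1           ≡⟨ cong (ℕ._∸ 1) (ℕ.*-distribʳ-+ d j t) ⟩
        j ℕ.* d ℕ.+ t ℕ.* d ℕ.∸ 1       ≡⟨ ℕ.+-∸-comm (t ℕ.* d) 1≤jd ⟩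
        j ℕ.* d ℕ.∸ 1 ℕ.+ t ℕ.* d       ≡⟨ ℕ.+-comm _ (t ℕ.* d) ⟩
        t ℕ.* d ℕ.+ (j ℕ.* d ℕ.∸ 1)     ∎
    Te*Pt≡Td : Te * + P t ≡ Td
    Te*Pt≡Td = trans (sym (pos-* (b ℕ.^ (t ℕ.* e)) (P t))) (cong +_ (b^[je]*P≡b^[jd] t))
    regroup : ∀ td te pt xd xe pj qj a → td * xd + te * xe * (pj * pt) + a * (td * qj)
                                        ≡ td * xd + (te * pt) * (xe * pj) + td * (a * qj)
    regroup = solve-∀
    factor : ∀ t x y z → t * x + t * y + t * z ≡ t * (x + y + z)
    factor = solve-∀

  steps-scale : ∀ k X j t → 1 ℕ.≤ j → steps k (b^ t * X) (j ℕ.+ t) ≡ b^ (t ℕ.* d ℕ.^ k) * steps k X j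
  steps-scale zero    X j t _   = cong (λ n → b^ n * X) (sym (ℕ.*-identityʳ t))
  steps-scale (suc k) X j t 1≤j = begin
    steps k (step (b^ t * X) (j ℕ.+ t)) ((j ℕ.+ t) ℕ.* d)
      ≡⟨ cong₂ (steps k) (step-scale X j t 1≤jd) (ℕ.*-distribʳ-+ d j t) ⟩
    steps k (b^ (t ℕ.* d) * step X j) (j ℕ.* d ℕ.+ t ℕ.* d)
      ≡⟨ steps-scale k (step X j) (j ℕ.* d) (t ℕ.* d) 1≤jd ⟩
    b^ (t ℕ.* d ℕ.* d ℕ.^ k) * steps (suc k) X j
      ≡⟨ cong (λ n → b^ n * steps (suc k) X j) (ℕ.*-assoc t d (d ℕ.^ k)) ⟩
    b^ (t ℕ.* d ℕ.^ suc k) * steps (suc k) X j ∎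
    where
    1≤jd : 1 ℕ.≤ j ℕ.* d
    1≤jd = ℕ.*-mono-≤ 1≤j 1≤d

  step-zero : ∀ j → step 0ℤ j ≡ a * + Q j
  step-zero j = begin
    0ℤ ^ d + 0ℤ ^ e * + P j + a * + Q j ≡⟨ cong₂ (λ u v → u + v * + P j + a * + Q j) (0^n≡0 d 1≤d) (0^n≡0 e 1≤e) ⟩
    0ℤ + 0ℤ * + P j + a * + Q j         ≡⟨ cong (λ z → z + a * + Q j) (*-zeroˡ (+ P j)) ⟩
    0ℤ + a * + Q j                      ≡⟨ +-identityˡ (a * + Q j) ⟩
    a * + Q j                           ∎

  X*X∣step-step₀ : ∀ X j → X * X ∣ step X j - step 0ℤ j
  X*X∣step-step₀ X j = subst (X * X ∣_) (sym difference)
    (∣m∣n⇒∣m+n (x*x∣x^n X (ℕ.≤-trans 2≤e e≤d)) (∣m⇒∣m*n (+ P j) (x*x∣x^n X 2≤e)))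
    where
    cancel : ∀ u v w → u + v + w - w ≡ u + v
    cancel = solve-∀
    difference : step X j - step 0ℤ j ≡ X ^ d + X ^ e * + P j
    difference = trans (cong (λ z → step X j - z) (step-zero j)) (cancel (X ^ d) (X ^ e * + P j) (a * + Q j))

  -- Modulo Z m ², Z (m + 1) = step (Z m) j ≡ step 0ℤ j = b ^ s · a, and the orbit of b ^ s · a
  -- is the orbit of a scaled by powers of b.
  Z-rigid : ∀ m k → ∃[ t ] Z m * Z m ∣ Z (m ℕ.+ suc k) - b^ t * Z k
  Z-rigid m k = s ℕ.* d ℕ.^ k , subst (λ z → Z m * Z m ∣ z - b^ (s ℕ.* d ℕ.^ k) * Z k) (sym Z[m+1+k]) congruent
    where
    j s : ℕ
    j = 1 ℕ.* d ℕ.^ m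
    s = j ℕ.* d ℕ.∸ 1
    1≤jd : 1 ℕ.≤ j ℕ.* d
    1≤jd = ℕ.*-mono-≤ (ℕ.*-mono-≤ (ℕ.≤-refl {1}) (1≤dⁱ m)) 1≤d
    Z[m+1+k] : Z (m ℕ.+ suc k) ≡ steps k (step (Z m) j) (j ℕ.* d)
    Z[m+1+k] = steps-+ m (suc k) a 1
    restarted : steps k (step 0ℤ j) (j ℕ.* d) ≡ b^ (s ℕ.* d ℕ.^ k) * Z k
    restarted = begin
      steps k (step 0ℤ j) (j ℕ.* d)       ≡⟨ cong₂ (steps k) (trans (step-zero j) (*-comm a (b^ s))) (sym (ℕ.m+[n∸m]≡n 1≤jd)) ⟩
      steps k (b^ s * a) (1 ℕ.+ s)        ≡⟨ steps-scale k a 1 s ℕ.≤-refl ⟩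
      b^ (s ℕ.* d ℕ.^ k) * Z k            ∎
    congruent : Z m * Z m ∣ steps k (step (Z m) j) (j ℕ.* d) - b^ (s ℕ.* d ℕ.^ k) * Z k
    congruent = subst (λ z → Z m * Z m ∣ steps k (step (Z m) j) (j ℕ.* d) - z) restarted
      (steps-cong-∣ k (j ℕ.* d) (X*X∣step-step₀ (Z m) j))

  Z-coprime : Coprime ∣ a ∣ b → ∀ i → Coprime ∣ Z i ∣ b
  Z-coprime a⊥b zero = a⊥b
  Z-coprime a⊥b (suc i) {q} (q∣Z , q∣b) =
    coprime-^ˡ d (Z-coprime a⊥b i) (subst (q ℕ.∣_) (abs-^ (Z i) d) (∣⇒∣ᵤ q∣Zᵈ) , q∣b)
    where
    D : ℕ
    D = d ℕ.^ i
    1≤D : 1 ℕ.≤ D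
    1≤D = 1≤dⁱ i
    q∣b^ : ∀ {n} → 1 ℕ.≤ n → + q ∣ b^ n
    q∣b^ {suc n} _ = ∣ᵤ⇒∣ (ℕ.∣m⇒∣m*n (b ℕ.^ n) q∣b)
    q∣step : + q ∣ step (Z i) D
    q∣step = subst (+ q ∣_) (Z-suc i) (∣ᵤ⇒∣ q∣Z)
    q∣Zᵈ+Zᵉ*P : + q ∣ Z i ^ d + Z i ^ e * + P D
    q∣Zᵈ+Zᵉ*P = ∣m+n∣n⇒∣m q∣step (∣n⇒∣m*n a (q∣b^ (ℕ.∸-monoˡ-≤ 1 (ℕ.*-mono-≤ 1≤D (ℕ.<⇒≤ (ℕ.≤-trans (s≤s 2≤e) e<d))))))
    q∣Zᵈ : + q ∣ Z i ^ d
    q∣Zᵈ = ∣m+n∣n⇒∣m q∣Zᵈ+Zᵉ*P (∣n⇒∣m*n (Z i ^ e) (q∣b^ (ℕ.*-mono-≤ 1≤D (ℕ.m<n⇒0<n∸m e<d))))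

  ∣Z[m+1+k]⇒∣Z[k] : ∀ {M} m k → M ℕ.∣ ∣ Z m ∣ ℕ.* ∣ Z m ∣ → Coprime M b →
                    M ℕ.∣ ∣ Z (m ℕ.+ suc k) ∣ → M ℕ.∣ ∣ Z k ∣
  ∣Z[m+1+k]⇒∣Z[k] {M} m k M∣Zm² M⊥b M∣Z[m+1+k] with Z-rigid m k
  ... | t , Zm²∣difference = coprime-divisor M⊥bᵗ (subst (M ℕ.∣_) (abs-* (b^ t) (Z k)) (∣⇒∣ᵤ M∣bᵗZk))
    where
    M⊥bᵗ : Coprime M (b ℕ.^ t)
    M⊥bᵗ = coprime-^ʳ t M⊥b
    M∣difference : + M ∣ Z (m ℕ.+ suc k) - b^ t * Z k
    M∣difference = ∣-trans (∣ᵤ⇒∣ (subst (M ℕ.∣_) (sym (abs-* (Z m) (Z m))) M∣Zm²)) Zm²∣difference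
    M∣bᵗZk : + M ∣ b^ t * Z k
    M∣bᵗZk = subst (+ M ∣_) (difference-cancel (Z (m ℕ.+ suc k)) (b^ t * Z k))
      (∣m∣n⇒∣m-n (∣ᵤ⇒∣ {i = Z (m ℕ.+ suc k)} M∣Z[m+1+k]) M∣difference)
      where
      difference-cancel : ∀ x y → x - (x - y) ≡ y
      difference-cancel = solve-∀

  -- If p ^ (v+1) divides Z (m+1+k), then p ^ (v+1) ∣ Z m ² (as p ∣ Z m and, by induction on v,
  -- p ^ v ∣ Z m), so p ^ (v+1) ∣ Z k by rigidity; descend on the index.
  Z-valuation-bounded : ∀ {p m} → Coprime p b → p ℕ.∣ ∣ Z m ∣ → (∀ {i} → i ℕ.< m → ¬ p ℕ.∣ ∣ Z i ∣) →
                        ∀ v n → p ℕ.^ v ℕ.∣ ∣ Z n ∣ → p ℕ.^ v ℕ.∣ ∣ Z m ∣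
  Z-valuation-bounded p⊥b p∣Zm before zero    n _ = ℕ.1∣ _
  Z-valuation-bounded {p} {m} p⊥b p∣Zm before (suc v) n = descend n (<-wellFounded n)
    where
    pᵛ⁺¹ : ℕ
    pᵛ⁺¹ = p ℕ.^ suc v
    descend : ∀ n → Acc ℕ._<_ n → pᵛ⁺¹ ℕ.∣ ∣ Z n ∣ → pᵛ⁺¹ ℕ.∣ ∣ Z m ∣
    descend n (acc rec) pᵛ⁺¹∣Zn with ℕ.<-cmp n m
    ... | tri< n<m _ _ = contradiction (ℕ.∣-trans (ℕ.m∣m*n (p ℕ.^ v)) pᵛ⁺¹∣Zn) (before n<m)
    ... | tri≈ _ refl _ = pᵛ⁺¹∣Zn
    ... | tri> _ _ m<n = descend k (rec k<n)
            (∣Z[m+1+k]⇒∣Z[k] m k pᵛ⁺¹∣Zm² (coprime-^ˡ (suc v) p⊥b) (subst (λ i → pᵛ⁺¹ ℕ.∣ ∣ Z i ∣) n≡m+1+k pᵛ⁺¹∣Zn))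
      where
      k : ℕ
      k = n ℕ.∸ suc m
      n≡m+1+k : n ≡ m ℕ.+ suc k
      n≡m+1+k = sym (trans (ℕ.+-suc m k) (ℕ.m+[n∸m]≡n m<n))
      k<n : k ℕ.< n
      k<n = ℕ.∸-monoʳ-< ℕ.z<s m<n
      pᵛ⁺¹∣Zm² : pᵛ⁺¹ ℕ.∣ ∣ Z m ∣ ℕ.* ∣ Z m ∣
      pᵛ⁺¹∣Zm² = ℕ.*-pres-∣ p∣Zm (Z-valuation-bounded p⊥b p∣Zm before v n (ℕ.∣-trans (ℕ.n∣m*n p) pᵛ⁺¹∣Zn))

module StepInequalities (d e : ℕ) (2≤e : 2 ℕ.≤ e) (e<d : e ℕ.< d) {b s B u P : ℕ}
                        (1≤b : 1 ℕ.≤ b) (1≤B : 1 ℕ.≤ B) (b<s : b ℕ.< s) (sB≤ub : s ℕ.* B ℕ.≤ u ℕ.* b)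
                        (P≡Bᵈ⁻ᵉ : P ≡ B ℕ.^ (d ℕ.∸ e)) where
  open import Data.Nat
  open import Data.Nat.Properties
  open import Data.Product using (_×_; _,_)
  open import Relation.Binary.PropositionalEquality

  open ≤-Reasoning

  private instance
    b≢0 : NonZero b
    b≢0 = >-nonZero 1≤b
    B≢0 : NonZero B
    B≢0 = >-nonZero 1≤B

  B<u : B < u
  B<u = *-cancelʳ-< b B u (begin-strict
    B * b ≡⟨ *-comm B b ⟩
    b * B <⟨ *-monoˡ-< B b<s ⟩
    s * B ≤⟨ sB≤ub ⟩
    u * b ∎)

  private instance
    u≢0 : NonZero u
    u≢0 = >-nonZero (<⇒≤ (≤-<-trans 1≤B B<u))

  sBⁿ≤buⁿ : ∀ {n} → 1 ≤ n → s * B ^ n ≤ b * u ^ n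
  sBⁿ≤buⁿ {suc n} _ = begin
    s * (B * B ^ n) ≡⟨ *-assoc s B (B ^ n) ⟨
    s * B * B ^ n   ≤⟨ *-mono-≤ sB≤ub (^-monoˡ-≤ n (<⇒≤ B<u)) ⟩
    u * b * u ^ n   ≡⟨ cong (_* u ^ n) (*-comm u b) ⟩
    b * u * u ^ n   ≡⟨ *-assoc b u (u ^ n) ⟩
    b * (u * u ^ n) ∎

  sQ≤uᵉP : ∀ {Q} → b * Q ≡ B ^ d → s * Q ≤ u ^ e * P
  sQ≤uᵉP {Q} bQ≡Bᵈ = *-cancelˡ-≤ b (begin
    b * (s * Q)       ≡⟨ *-comm b (s * Q) ⟩
    s * Q * b         ≡⟨ *-assoc s Q b ⟩
    s * (Q * b)       ≡⟨ cong (s *_) (trans (*-comm Q b) bQ≡Bᵈ) ⟩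
    s * B ^ d         ≡⟨ cong (λ n → s * B ^ n) (m+[n∸m]≡n (<⇒≤ e<d)) ⟨
    s * B ^ (e + (d ∸ e)) ≡⟨ cong (s *_) (trans (^-distribˡ-+-* B e (d ∸ e)) (cong (B ^ e *_) (sym P≡Bᵈ⁻ᵉ))) ⟩
    s * (B ^ e * P)   ≡⟨ *-assoc s (B ^ e) P ⟨
    s * B ^ e * P     ≤⟨ *-monoˡ-≤ P (sBⁿ≤buⁿ (≤-trans (s≤s z≤n) 2≤e)) ⟩
    b * u ^ e * P     ≡⟨ *-assoc b (u ^ e) P ⟩
    b * (u ^ e * P)   ∎)

  uᵉP+uᵉ≤uᵈ : u ^ e * P + u ^ e ≤ u ^ d
  uᵉP+uᵉ≤uᵈ = begin
    u ^ e * P + u ^ e     ≡⟨ cong (u ^ e * P +_) (*-identityʳ (u ^ e)) ⟨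
    u ^ e * P + u ^ e * 1 ≡⟨ *-distribˡ-+ (u ^ e) P 1 ⟨
    u ^ e * (P + 1)       ≤⟨ *-monoʳ-≤ (u ^ e) (subst (_≤ u ^ (d ∸ e)) (+-comm 1 P) P<uᵈ⁻ᵉ) ⟩
    u ^ e * u ^ (d ∸ e)   ≡⟨ ^-distribˡ-+-* u e (d ∸ e) ⟨
    u ^ (e + (d ∸ e))     ≡⟨ cong (u ^_) (m+[n∸m]≡n (<⇒≤ e<d)) ⟩
    u ^ d                 ∎
    where
    P<uᵈ⁻ᵉ : P < u ^ (d ∸ e)
    P<uᵈ⁻ᵉ = subst (_< u ^ (d ∸ e)) (sym P≡Bᵈ⁻ᵉ) (^-monoˡ-< (d ∸ e) {{>-nonZero (m<n⇒0<n∸m e<d)}} B<u)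

  u*u≤uⁿ : ∀ {n} → 2 ≤ n → u * u ≤ u ^ n
  u*u≤uⁿ {suc (suc n)} (s≤s (s≤s z≤n)) = begin
    u * u             ≡⟨ *-identityʳ (u * u) ⟨
    u * u * 1         ≤⟨ *-monoʳ-≤ (u * u) (m^n>0 u n) ⟩
    u * u * u ^ n     ≡⟨ *-assoc u u (u ^ n) ⟩
    u * (u * u ^ n)   ∎

  lower-bound⇒growth : ∀ {Q V} → 1 ≤ Q → u ^ d ∸ u ^ e * P + s * Q ≤ V →
                            s * Q ≤ V × u * u < V
  lower-bound⇒growth {Q} {V} 1≤Q lower = ≤-trans (m≤n+m (s * Q) _) lower , (begin-strict
    u * u               <⟨ m<m+n (u * u) 0<sQ ⟩
    u * u + s * Q       ≤⟨ +-monoˡ-≤ (s * Q) (≤-trans (u*u≤uⁿ 2≤e) uᵉ≤uᵈ-uᵉP) ⟩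
    u ^ d ∸ u ^ e * P + s * Q ≤⟨ lower ⟩
    V                   ∎)
    where
    0<sQ : 0 < s * Q
    0<sQ = *-mono-≤ (≤-trans (s≤s z≤n) b<s) 1≤Q
    uᵉ≤uᵈ-uᵉP : u ^ e ≤ u ^ d ∸ u ^ e * P
    uᵉ≤uᵈ-uᵉP = subst (_≤ u ^ d ∸ u ^ e * P) (m+n∸m≡n (u ^ e * P) (u ^ e)) (∸-monoˡ-≤ (u ^ e * P) uᵉP+uᵉ≤uᵈ)

module Growth (d e b s : ℕ) (2≤e : 2 ℕ.≤ e) (e<d : e ℕ.< d) (1≤b : 1 ℕ.≤ b) (b<s : b ℕ.< s)
              (parity : (¬ 2 ℕ.∣ d) ⊎ (2 ℕ.∣ e)) where
  open import Data.Nat as ℕ using (ℕ; zero; suc)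
  import Data.Nat.Properties as ℕ
  import Data.Nat.Divisibility as ℕ
  open import Data.Integer using (ℤ; +_; ∣_∣; _+_; _*_; _-_; -_; _^_; _≤_)
  open import Data.Integer.Properties
  open import Data.Integer.Tactic.RingSolver using (solve-∀)
  open import Data.Product using (_×_; _,_; proj₁; proj₂)
  open import Data.Sum using (_⊎_; inj₁; inj₂)
  open import Relation.Nullary using (¬_)
  open import Relation.Binary.PropositionalEquality
  open IntegerPowers

  open NumeratorSequence d e b (- + s) 2≤e e<d

  private instance
    b≢0 : ℕ.NonZero b
    b≢0 = ℕ.>-nonZero 1≤b

  module _ (X : ℤ) (j : ℕ) (1≤j : 1 ℕ.≤ j) (invariant : s ℕ.* b ℕ.^ j ℕ.≤ ∣ X ∣ ℕ.* b) where
    open StepInequalities d e 2≤e e<d {u = ∣ X ∣} 1≤b (ℕ.m^n>0 b j) b<s invariant (sym (ℕ.^-*-assoc b j (d ℕ.∸ e)))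

    private
      u U E S : ℕ
      u = ∣ X ∣
      U = u ℕ.^ d
      E = u ℕ.^ e ℕ.* P j
      S = s ℕ.* Q j
      1≤jd : 1 ℕ.≤ j ℕ.* d
      1≤jd = ℕ.*-mono-≤ 1≤j 1≤d
      bQ≡Bᵈ : b ℕ.* Q j ≡ (b ℕ.^ j) ℕ.^ d
      bQ≡Bᵈ = trans (b*Q≡b^[jd] j 1≤jd) (sym (ℕ.^-*-assoc b j d))

    step-expand : step X j ≡ X ^ d + X ^ e * + P j - + S
    step-expand = cong (λ q → X ^ d + X ^ e * + P j + q)
      (trans (sym (neg-distribˡ-* (+ s) (+ Q j))) (cong -_ (sym (pos-* s (Q j)))))

    E≤U : E ℕ.≤ U
    E≤U = ℕ.≤-trans (ℕ.m≤m+n E _) uᵉP+uᵉ≤uᵈ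

    step≡U+[E∸S] : X ^ d ≡ + U → X ^ e ≡ + (u ℕ.^ e) → step X j ≡ + (U ℕ.+ (E ℕ.∸ S))
    step≡U+[E∸S] Xᵈ≡U Xᵉ≡uᵉ = begin
      step X j                     ≡⟨ step-expand ⟩
      X ^ d + X ^ e * + P j - + S  ≡⟨ cong₂ (λ x y → x + y * + P j - + S) Xᵈ≡U Xᵉ≡uᵉ ⟩
      + U + + (u ℕ.^ e) * + P j - + S ≡⟨ cong (λ z → + U + z - + S) (sym (pos-* (u ℕ.^ e) (P j))) ⟩
      + U + + E - + S              ≡⟨ +-assoc (+ U) (+ E) (- + S) ⟩
      + U + (+ E - + S)            ≡⟨ cong (λ z → + U + z) (+m-+n≡+[m∸n] (sQ≤uᵉP bQ≡Bᵈ)) ⟩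
      + U + + (E ℕ.∸ S)            ≡⟨ pos-+ U (E ℕ.∸ S) ⟨
      + (U ℕ.+ (E ℕ.∸ S))          ∎
      where open ≡-Reasoning

    -- The parity hypothesis rules out X ^ d > 0 > X ^ e, the only sign pattern in which
    -- both X ^ e P and the constant term - s Q pull against X ^ d.
    step-lower-bound : U ℕ.∸ E ℕ.+ S ℕ.≤ ∣ step X j ∣
    step-lower-bound with ^-sign-pattern parity X
    ... | inj₁ (Xᵈ≡U , Xᵉ≡uᵉ) = begin
        U ℕ.∸ E ℕ.+ S        ≤⟨ ℕ.+-monoʳ-≤ (U ℕ.∸ E) (sQ≤uᵉP bQ≡Bᵈ) ⟩
        U ℕ.∸ E ℕ.+ E        ≡⟨ ℕ.m∸n+n≡m E≤U ⟩
        U                    ≤⟨ ℕ.m≤m+n U (E ℕ.∸ S) ⟩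
        U ℕ.+ (E ℕ.∸ S)      ≡⟨ cong ∣_∣ (step≡U+[E∸S] Xᵈ≡U Xᵉ≡uᵉ) ⟨
        ∣ step X j ∣         ∎
      where
      open ℕ.≤-Reasoning
    ... | inj₂ Xᵈ≡-U = subst (U ℕ.∸ E ℕ.+ S ℕ.≤_) (∣-i∣≡∣i∣ (step X j)) (+n≤i⇒n≤∣i∣ (begin
        + (U ℕ.∸ E ℕ.+ S)            ≡⟨ pos-+ (U ℕ.∸ E) S ⟩
        + (U ℕ.∸ E) + + S            ≡⟨ cong (_+ + S) (+m-+n≡+[m∸n] E≤U) ⟨
        + U - + E + + S              ≤⟨ +-monoˡ-≤ (+ S) (+-monoʳ-≤ (+ U) (neg-mono-≤ T≤E)) ⟩
        + U - T + + S                ≡⟨ negate (+ U) T (+ S) ⟨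
        - (- + U + T - + S)          ≡⟨ cong (λ x → - (x + T - + S)) Xᵈ≡-U ⟨
        - (X ^ d + T - + S)          ≡⟨ cong -_ step-expand ⟨
        - step X j                   ∎))
      where
      open ≤-Reasoning
      T : ℤ
      T = X ^ e * + P j
      T≤E : T ≤ + E
      T≤E = ≤-trans (i≤+∣i∣ T) (≤-reflexive (cong +_ (trans (abs-* (X ^ e) (+ P j)) (cong (ℕ._* P j) (abs-^ X e)))))
      negate : ∀ x t y → - (- x + t - y) ≡ x - t + y
      negate = solve-∀

    step-growth : s ℕ.* b ℕ.^ (j ℕ.* d) ℕ.≤ ∣ step X j ∣ ℕ.* b × u ℕ.* u ℕ.< ∣ step X j ∣
    step-growth with lower-bound⇒growth (ℕ.m^n>0 b (j ℕ.* d ℕ.∸ 1)) step-lower-bound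
    ... | S≤V , u²<V = ℕ.≤-trans (ℕ.≤-reflexive s*bʲᵈ≡S*b) (ℕ.*-monoˡ-≤ b S≤V) , u²<V
      where
      s*bʲᵈ≡S*b : s ℕ.* b ℕ.^ (j ℕ.* d) ≡ S ℕ.* b
      s*bʲᵈ≡S*b = trans (cong (s ℕ.*_) (trans (sym (b*Q≡b^[jd] j 1≤jd)) (ℕ.*-comm b (Q j)))) (sym (ℕ.*-assoc s (Q j) b))

  Z-invariant : ∀ i → s ℕ.* b ℕ.^ (d ℕ.^ i) ℕ.≤ ∣ Z i ∣ ℕ.* b
  Z-invariant zero    = ℕ.≤-reflexive (trans (cong (s ℕ.*_) (ℕ.*-identityʳ b)) (cong (ℕ._* b) (sym (∣-i∣≡∣i∣ (+ s)))))
  Z-invariant (suc i) = subst₂ (λ n z → s ℕ.* b ℕ.^ n ℕ.≤ ∣ z ∣ ℕ.* b) (ℕ.*-comm (d ℕ.^ i) d) (sym (Z-suc i))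
    (proj₁ (step-growth (Z i) (d ℕ.^ i) (1≤dⁱ i) (Z-invariant i)))

  Z-growth : ∀ i → ∣ Z i ∣ ℕ.* ∣ Z i ∣ ℕ.< ∣ Z (suc i) ∣
  Z-growth i = subst (λ z → ∣ Z i ∣ ℕ.* ∣ Z i ∣ ℕ.< ∣ z ∣) (sym (Z-suc i))
    (proj₂ (step-growth (Z i) (d ℕ.^ i) (1≤dⁱ i) (Z-invariant i)))

module Fractions where

  open import Data.Nat as ℕ using (ℕ; zero; suc)
  import Data.Nat.Properties as ℕ
  import Data.Nat.Divisibility as ℕ
  open import Data.Nat.Coprimality as Coprime using (Coprime; coprime-divisor)
  open import Data.Integer using (ℤ; +_; ∣_∣; _+_; _*_; _^_; 0ℤ)
  open import Data.Integer.Properties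
  open import Data.Integer.Tactic.RingSolver using (solve-∀)
  open import Data.Rational using (ℚ; mkℚ; toℚᵘ; ↥_; ↧ₙ_; 0ℚ) renaming (_+_ to _+ℚ_; _*_ to _*ℚ_)
  open import Data.Rational.Properties using (toℚᵘ-homo-+; toℚᵘ-homo-*)
  open import Data.Rational.Unnormalised.Properties using (≃-sym)
  open import Data.Rational.Unnormalised as ℚᵘ using (ℚᵘ; mkℚᵘ; _≃_; *≡*)
  open import Relation.Binary.PropositionalEquality

  open ≡-Reasoning

  infix 4 _≋_/_

  record _≋_/_ (x : ℚᵘ) (X : ℤ) (D : ℕ) : Set where
    constructor cross
    field cross-eq : ℚᵘ.↥ x * + D ≡ X * ℚᵘ.↧ x

  private
    swap₂₃ : ∀ x y z → x * y * z ≡ x * z * y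
    swap₂₃ = solve-∀

  ≋-resp-≃ : ∀ {x y X D} → x ≃ y → x ≋ X / D → y ≋ X / D
  ≋-resp-≃ {mkℚᵘ n m} {mkℚᵘ n′ m′} {X} {D} (*≡* n*m′≡n′*m) (cross eq) = cross (*-cancelʳ-≡ _ _ (+ suc m) (begin
    n′ * + D * + suc m  ≡⟨ swap₂₃ n′ (+ D) (+ suc m) ⟩
    n′ * + suc m * + D  ≡⟨ cong (_* + D) n*m′≡n′*m ⟨
    n * + suc m′ * + D  ≡⟨ swap₂₃ n (+ suc m′) (+ D) ⟩
    n * + D * + suc m′  ≡⟨ cong (_* + suc m′) eq ⟩
    X * + suc m * + suc m′ ≡⟨ swap₂₃ X (+ suc m) (+ suc m′) ⟩
    X * + suc m′ * + suc m ∎))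

  ≋-rescale : ∀ {x X D X′ D′} → .{{ℕ.NonZero D}} → x ≋ X / D → X * + D′ ≡ X′ * + D → x ≋ X′ / D′
  ≋-rescale {mkℚᵘ n m} {X} {D} {X′} {D′} (cross eq) X*D′≡X′*D = cross (*-cancelʳ-≡ _ _ (+ D) (begin
    n * + D′ * + D      ≡⟨ swap₂₃ n (+ D′) (+ D) ⟩
    n * + D * + D′      ≡⟨ cong (_* + D′) eq ⟩
    X * + suc m * + D′  ≡⟨ swap₂₃ X (+ suc m) (+ D′) ⟩
    X * + D′ * + suc m  ≡⟨ cong (_* + suc m) X*D′≡X′*D ⟩
    X′ * + D * + suc m  ≡⟨ swap₂₃ X′ (+ D) (+ suc m) ⟩
    X′ * + suc m * + D  ∎))

  ≋-+ : ∀ {x y X Y D E} → x ≋ X / D → y ≋ Y / E → x ℚᵘ.+ y ≋ X * + E + Y * + D / D ℕ.* E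
  ≋-+ {mkℚᵘ n m} {mkℚᵘ n′ m′} {X} {Y} {D} {E} (cross eqˣ) (cross eqʸ) = cross (begin
    (n * k′ + n′ * k) * + (D ℕ.* E)         ≡⟨ cong ((n * k′ + n′ * k) *_) (pos-* D E) ⟩
    (n * k′ + n′ * k) * (+ D * + E)         ≡⟨ spread n k n′ k′ (+ D) (+ E) ⟩
    n * + D * (k′ * + E) + n′ * + E * (k * + D) ≡⟨ cong₂ (λ u v → u * (k′ * + E) + v * (k * + D)) eqˣ eqʸ ⟩
    X * k * (k′ * + E) + Y * k′ * (k * + D) ≡⟨ collect X Y k k′ (+ D) (+ E) ⟩
    (X * + E + Y * + D) * (k * k′)          ≡⟨ cong ((X * + E + Y * + D) *_) (pos-* (suc m) (suc m′)) ⟨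
    (X * + E + Y * + D) * + (suc m ℕ.* suc m′) ∎)
    where
    k k′ : ℤ
    k = + suc m
    k′ = + suc m′
    spread : ∀ n k n′ k′ D E → (n * k′ + n′ * k) * (D * E) ≡ n * D * (k′ * E) + n′ * E * (k * D)
    spread = solve-∀
    collect : ∀ X Y k k′ D E → X * k * (k′ * E) + Y * k′ * (k * D) ≡ (X * E + Y * D) * (k * k′)
    collect = solve-∀

  ≋-* : ∀ {x y X Y D E} → x ≋ X / D → y ≋ Y / E → x ℚᵘ.* y ≋ X * Y / D ℕ.* E
  ≋-* {mkℚᵘ n m} {mkℚᵘ n′ m′} {X} {Y} {D} {E} (cross eqˣ) (cross eqʸ) = cross (begin
    n * n′ * + (D ℕ.* E)      ≡⟨ cong (n * n′ *_) (pos-* D E) ⟩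
    n * n′ * (+ D * + E)      ≡⟨ interchange n n′ (+ D) (+ E) ⟩
    n * + D * (n′ * + E)      ≡⟨ cong₂ _*_ eqˣ eqʸ ⟩
    X * k * (Y * k′)          ≡⟨ interchange X k Y k′ ⟩
    X * Y * (k * k′)          ≡⟨ cong (X * Y *_) (pos-* (suc m) (suc m′)) ⟨
    X * Y * + (suc m ℕ.* suc m′) ∎)
    where
    k k′ : ℤ
    k = + suc m
    k′ = + suc m′
    interchange : ∀ a b c d → a * b * (c * d) ≡ a * c * (b * d)
    interchange = solve-∀

  ≋-toℚᵘ-+ : ∀ {p q X Y D E} → toℚᵘ p ≋ X / D → toℚᵘ q ≋ Y / E → toℚᵘ (p +ℚ q) ≋ X * + E + Y * + D / D ℕ.* E
  ≋-toℚᵘ-+ {p} {q} p≋ q≋ = ≋-resp-≃ (≃-sym (toℚᵘ-homo-+ p q)) (≋-+ p≋ q≋)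

  ≋-toℚᵘ-* : ∀ {p q X Y D E} → toℚᵘ p ≋ X / D → toℚᵘ q ≋ Y / E → toℚᵘ (p *ℚ q) ≋ X * Y / D ℕ.* E
  ≋-toℚᵘ-* {p} {q} p≋ q≋ = ≋-resp-≃ (≃-sym (toℚᵘ-homo-* p q)) (≋-* p≋ q≋)

  ≋-toℚᵘ-^ : ∀ {q X D} → toℚᵘ q ≋ X / D → ∀ k → toℚᵘ (q ^ᵠ k) ≋ X ^ k / D ℕ.^ k
  ≋-toℚᵘ-^ q≋ zero    = cross refl
  ≋-toℚᵘ-^ q≋ (suc k) = ≋-toℚᵘ-* q≋ (≋-toℚᵘ-^ q≋ k)

  ≋-toℚᵘ : ∀ q → toℚᵘ q ≋ ↥ q / ↧ₙ q
  ≋-toℚᵘ (mkℚ n m _) = cross refl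

  0≋0/D : ∀ D → toℚᵘ 0ℚ ≋ 0ℤ / D
  0≋0/D D = cross refl

  ≋-coprime⇒∣↥∣ : ∀ {q X D} → .{{ℕ.NonZero D}} → toℚᵘ q ≋ X / D → Coprime ∣ X ∣ D → ∣ ↥ q ∣ ≡ ∣ X ∣
  ≋-coprime⇒∣↥∣ {mkℚ n m n⊥m} {X} {D} (cross eq) X⊥D =
    ℕ.*-cancelʳ-≡ ∣ n ∣ ∣ X ∣ D (trans ∣n∣*D≡∣X∣*[1+m] (cong (∣ X ∣ ℕ.*_) (sym D≡1+m)))
    where
    ∣n∣*D≡∣X∣*[1+m] : ∣ n ∣ ℕ.* D ≡ ∣ X ∣ ℕ.* suc m
    ∣n∣*D≡∣X∣*[1+m] = trans (sym (abs-* n (+ D))) (trans (cong ∣_∣ eq) (abs-* X (+ suc m)))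
    D≡1+m : D ≡ suc m
    D≡1+m = ℕ.∣-antisym
      (coprime-divisor (Coprime.sym X⊥D) (subst (D ℕ.∣_) ∣n∣*D≡∣X∣*[1+m] (ℕ.n∣m*n ∣ n ∣)))
      (coprime-divisor (Coprime.sym (Coprime.recompute n⊥m)) (subst (suc m ℕ.∣_) (sym ∣n∣*D≡∣X∣*[1+m]) (ℕ.n∣m*n ∣ X ∣)))

  ↥-↧ₙ-coprime : ∀ q → Coprime ∣ ↥ q ∣ (↧ₙ q)
  ↥-↧ₙ-coprime (mkℚ n m n⊥m) = Coprime.recompute n⊥m

module Orbit (d e : ℕ) (c : ℚ) (2≤e : 2 ℕ.≤ e) (e<d : e ℕ.< d) where
  open import Data.Nat as ℕ using (ℕ; zero; suc)
  import Data.Nat.Properties as ℕ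
  open import Data.Integer using (ℤ; +_; ∣_∣; _+_; _*_; _^_)
  open import Data.Integer.Properties using (pos-*; *-assoc)
  open import Data.Integer.Tactic.RingSolver using (solve-∀)
  open import Data.Rational using (ℚ; toℚᵘ; ↥_; ↧ₙ_; 0ℚ)
  open import Data.Rational.Unnormalised using (ℚᵘ)
  open import Relation.Binary.PropositionalEquality
  open Divisibility
  open Fractions
  open ≡-Reasoning

  open NumeratorSequence d e (↧ₙ c) (↥ c) 2≤e e<d

  private
    b : ℕ
    b = ↧ₙ c
    a : ℤ
    a = ↥ c

  rescale-identity : ∀ xd xe a b t be p q → be * p ≡ t → q * b ≡ t →
                     ((xd * be + xe * t) * b + a * (t * be)) * t ≡ (xd + xe * p + a * q) * (t * be * b)
  rescale-identity xd xe a b t be p q be*p≡t q*b≡t = begin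
    ((xd * be + xe * t) * b + a * (t * be)) * t ≡⟨ expand₁ xd xe a b t be ⟩
    xd * t * be * b + xe * t * t * b + a * t * t * be
      ≡⟨ cong₂ (λ u v → xd * t * be * b + xe * u * t * b + a * v * t * be) be*p≡t q*b≡t ⟨
    xd * t * be * b + xe * (be * p) * t * b + a * (q * b) * t * be ≡⟨ expand₂ xd xe a b t be p q ⟨
    (xd + xe * p + a * q) * (t * be * b) ∎
    where
    expand₁ : ∀ xd xe a b t be → ((xd * be + xe * t) * b + a * (t * be)) * t
                                ≡ xd * t * be * b + xe * t * t * b + a * t * t * be
    expand₁ = solve-∀
    expand₂ : ∀ xd xe a b t be p q → (xd + xe * p + a * q) * (t * be * b)
                                     ≡ xd * t * be * b + xe * (be * p) * t * b + a * (q * b) * t * be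
    expand₂ = solve-∀

  poly-≋ : ∀ {x X} j → 1 ℕ.≤ j → toℚᵘ x ≋ X / b ℕ.^ j → toℚᵘ (poly d e c x) ≋ step X j / (b ℕ.^ j) ℕ.^ d
  poly-≋ {x} {X} j 1≤j x≋X/B = ≋-rescale {{nonZero}} sum≋ (begin
    ((X ^ d * + Bᵉ + X ^ e * + Bᵈ) * + b + a * + (Bᵈ ℕ.* Bᵉ)) * + Bᵈ
      ≡⟨ cong (λ z → ((X ^ d * + Bᵉ + X ^ e * + Bᵈ) * + b + a * z) * + Bᵈ) (pos-* Bᵈ Bᵉ) ⟩
    ((X ^ d * + Bᵉ + X ^ e * + Bᵈ) * + b + a * (+ Bᵈ * + Bᵉ)) * + Bᵈ
      ≡⟨ rescale-identity (X ^ d) (X ^ e) a (+ b) (+ Bᵈ) (+ Bᵉ) (+ P j) (+ Q j) Bᵉ*P≡Bᵈ Q*b≡Bᵈ ⟩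
    step X j * (+ Bᵈ * + Bᵉ * + b)
      ≡⟨ cong (step X j *_) (trans (cong (_* + b) (sym (pos-* Bᵈ Bᵉ))) (sym (pos-* (Bᵈ ℕ.* Bᵉ) b))) ⟩
    step X j * + (Bᵈ ℕ.* Bᵉ ℕ.* b) ∎)
    where
    B Bᵈ Bᵉ : ℕ
    B = b ℕ.^ j
    Bᵈ = B ℕ.^ d
    Bᵉ = B ℕ.^ e
    sum≋ : toℚᵘ (poly d e c x) ≋ (X ^ d * + Bᵉ + X ^ e * + Bᵈ) * + b + a * + (Bᵈ ℕ.* Bᵉ) / Bᵈ ℕ.* Bᵉ ℕ.* b
    sum≋ = ≋-toℚᵘ-+ (≋-toℚᵘ-+ (≋-toℚᵘ-^ x≋X/B d) (≋-toℚᵘ-^ x≋X/B e)) (≋-toℚᵘ c)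
    nonZero : ℕ.NonZero (Bᵈ ℕ.* Bᵉ ℕ.* b)
    nonZero = ℕ.m*n≢0 _ b {{ℕ.m*n≢0 Bᵈ Bᵉ {{ℕ.m^n≢0 B d {{B≢0}}}} {{ℕ.m^n≢0 B e {{B≢0}}}}}}
      where
      B≢0 : ℕ.NonZero B
      B≢0 = ℕ.m^n≢0 b j
    Bᵉ*P≡Bᵈ : + Bᵉ * + P j ≡ + Bᵈ
    Bᵉ*P≡Bᵈ = trans (sym (pos-* Bᵉ (P j))) (cong +_ (begin
      Bᵉ ℕ.* P j            ≡⟨ cong (ℕ._* P j) (ℕ.^-*-assoc b j e) ⟩
      b ℕ.^ (j ℕ.* e) ℕ.* P j ≡⟨ b^[je]*P≡b^[jd] j ⟩
      b ℕ.^ (j ℕ.* d)       ≡⟨ ℕ.^-*-assoc b j d ⟨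
      Bᵈ                    ∎))
    Q*b≡Bᵈ : + Q j * + b ≡ + Bᵈ
    Q*b≡Bᵈ = trans (sym (pos-* (Q j) b)) (cong +_ (begin
      Q j ℕ.* b       ≡⟨ ℕ.*-comm (Q j) b ⟩
      b ℕ.* Q j       ≡⟨ b*Q≡b^[jd] j (ℕ.*-mono-≤ 1≤j 1≤d) ⟩
      b ℕ.^ (j ℕ.* d) ≡⟨ ℕ.^-*-assoc b j d ⟨
      Bᵈ              ∎))

  iter-≋ : ∀ i → toℚᵘ (iter (poly d e c) (suc i) 0ℚ) ≋ Z i / b ℕ.^ (d ℕ.^ i)
  iter-≋ zero = ≋-rescale {{ℕ.m^n≢0 (b ℕ.^ 1) d}} (poly-≋ 1 ℕ.≤-refl (0≋0/D (b ℕ.^ 1))) (begin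
    step (+ 0) 1 * + (b ℕ.^ 1)      ≡⟨ cong (_* + (b ℕ.^ 1)) (step-zero 1) ⟩
    a * + Q 1 * + (b ℕ.^ 1)        ≡⟨ *-assoc a (+ Q 1) (+ (b ℕ.^ 1)) ⟩
    a * (+ Q 1 * + (b ℕ.^ 1))      ≡⟨ cong (a *_) (trans (sym (pos-* (Q 1) (b ℕ.^ 1))) (cong +_ Q*b≡b^d)) ⟩
    a * + ((b ℕ.^ 1) ℕ.^ d)        ∎)
    where
    Q*b≡b^d : Q 1 ℕ.* b ℕ.^ 1 ≡ (b ℕ.^ 1) ℕ.^ d
    Q*b≡b^d = begin
      Q 1 ℕ.* b ℕ.^ 1   ≡⟨ ℕ.*-comm (Q 1) (b ℕ.^ 1) ⟩
      b ℕ.^ 1 ℕ.* Q 1   ≡⟨ cong (ℕ._* Q 1) (ℕ.*-identityʳ b) ⟩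
      b ℕ.* Q 1         ≡⟨ b*Q≡b^[jd] 1 (ℕ.*-mono-≤ (ℕ.≤-refl {1}) 1≤d) ⟩
      b ℕ.^ (1 ℕ.* d)   ≡⟨ ℕ.^-*-assoc b 1 d ⟨
      (b ℕ.^ 1) ℕ.^ d   ∎
  iter-≋ (suc i) = subst₂ (λ X n → f²⁺ⁱ ≋ X / b ℕ.^ n) (sym (Z-suc i)) (ℕ.*-comm (d ℕ.^ i) d)
    (subst (λ D → f²⁺ⁱ ≋ step (Z i) (d ℕ.^ i) / D) (ℕ.^-*-assoc b (d ℕ.^ i) d) (poly-≋ (d ℕ.^ i) (1≤dⁱ i) (iter-≋ i)))
    where
    f²⁺ⁱ : ℚᵘ
    f²⁺ⁱ = toℚᵘ (iter (poly d e c) (suc (suc i)) 0ℚ)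

  A≡∣Z∣ : ∀ i → A (poly d e c) (suc i) ≡ ∣ Z i ∣
  A≡∣Z∣ i = ≋-coprime⇒∣↥∣ {{ℕ.m^n≢0 b (d ℕ.^ i)}} (iter-≋ i)
    (coprime-^ʳ (d ℕ.^ i) (Z-coprime (↥-↧ₙ-coprime c) i))

module NewPrimeDivisors where

  open import Data.Nat
  open import Data.Nat.Properties
  open import Data.Nat.Divisibility
  open import Data.Nat.Primality using (Prime)
  open import Data.Product using (∃-syntax; _×_; _,_)
  open import Data.Sum using (_⊎_; inj₁; inj₂)
  open import Relation.Nullary using (¬_; yes; no)
  open import Relation.Unary using (Decidable)
  open import Relation.Binary.PropositionalEquality
  open Divisibility

  Least : (ℕ → Set) → ℕ → Set
  Least P m = P m × (∀ {k} → k < m → ¬ P k)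

  least-below : ∀ {P : ℕ → Set} → Decidable P → ∀ n → (∀ {k} → k < n → ¬ P k) ⊎ ∃[ m ] m < n × Least P m
  least-below P? zero = inj₁ λ ()
  least-below {P} P? (suc n) with least-below P? n
  ... | inj₂ (m , m<n , least) = inj₂ (m , m<n⇒m<1+n m<n , least)
  ... | inj₁ none with P? n
  ...   | yes Pn = inj₂ (n , ≤-refl , Pn , none)
  ...   | no ¬Pn = inj₁ λ k<1+n → case (m<1+n⇒m<n∨m≡n k<1+n)
    where
    case : ∀ {k} → k < n ⊎ k ≡ n → ¬ P k
    case (inj₁ k<n) = none k<n
    case (inj₂ refl) = ¬Pn

  module _ (W : ℕ → ℕ) where

    ∏< : ℕ → ℕ
    ∏< zero    = 1
    ∏< (suc k) = ∏< k * W k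

    W∣∏< : ∀ {m k} → m < k → W m ∣ ∏< k
    W∣∏< {m} {suc k} m<1+k with m<1+n⇒m<n∨m≡n m<1+k
    ... | inj₁ m<k  = ∣m⇒∣m*n (W k) (W∣∏< m<k)
    ... | inj₂ refl = n∣m*n (∏< k)

    module _ (1<W₀ : 1 < W 0) (grow : ∀ k → W k * W k < W (suc k)) where

      ∏<-< : ∀ k → ∏< k < W k
      ∏<-< zero    = 1<W₀
      ∏<-< (suc k) = <-trans (*-monoˡ-< (W k) {{>-nonZero (≤-trans (s≤s z≤n) (∏<-< k))}} (∏<-< k)) (grow k)

      1≤∏< : ∀ k → 1 ≤ ∏< k
      1≤∏< zero    = ≤-refl
      1≤∏< (suc k) = *-mono-≤ (1≤∏< k) (≤-trans (1≤∏< k) (<⇒≤ (∏<-< k)))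

      new-prime-divisor : (∀ {p m} → Least (λ k → p ∣ W k) m → ∀ v n → p ^ v ∣ W n → p ^ v ∣ W m) →
                          ∀ i → ¬ (∀ p → Prime p → p ∣ W i → ∃[ m ] m < i × Least (λ k → p ∣ W k) m)
      new-prime-divisor valuation-bounded i earlier = <⇒≱ (∏<-< i) (∣⇒≤ {{>-nonZero (1≤∏< i)}} Wᵢ∣∏<)
        where
        instance
          Wᵢ≢0 : NonZero (W i)
          Wᵢ≢0 = >-nonZero (≤-trans (1≤∏< i) (<⇒≤ (∏<-< i)))
        Wᵢ∣∏< : W i ∣ ∏< i
        Wᵢ∣∏< = ∣-by-prime-powers λ where
          zero    _  _        → 1∣ _
          (suc v) pp pᵛ⁺¹∣Wᵢ → let m , m<i , least = earlier _ pp (∣-trans (m∣m*n _) pᵛ⁺¹∣Wᵢ)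
                                in ∣-trans (valuation-bounded least (suc v) i pᵛ⁺¹∣Wᵢ) (W∣∏< m<i)

open import Data.Nat using (_<_; _≤_; zero; suc; s≤s; z≤n)
open import Data.Nat.Divisibility using (_∣_; _∣?_)
open import Data.Nat.Coprimality using (Coprime)
open import Data.Nat.Primality using (Prime)
open import Data.Integer as ℤ using (+_; -[1+_]; ∣_∣)
import Data.Integer.Properties as ℤ
open import Data.Rational using (mkℚ; *<*; -_; 1ℚ) renaming (_<_ to _<ℚ_; _+_ to _+ℚ_)
open import Data.Product using (∃-syntax; _×_; _,_)
open import Data.Sum using (inj₁; inj₂)
open import Function using (_∘_)
open import Relation.Nullary using (contradiction)
open import Relation.Binary.PropositionalEquality using (sym; subst; subst₂)
open Divisibility using (∣⇒coprimeˡ)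
open Fractions using (↥-↧ₙ-coprime)
open NewPrimeDivisors using (Least; least-below; new-prime-divisor)

module ZsigmondySet (d e b′ s′ : ℕ) (2≤e : 2 ≤ e) (e<d : e < d) (b′<s′ : b′ < s′) .(a⊥b : Coprime (suc s′) (suc b′))
                  (parity : (¬ 2 ∣ d) ⊎ (2 ∣ e)) where
  c : ℚ
  c = mkℚ -[1+ s′ ] b′ a⊥b

  open NumeratorSequence d e (suc b′) -[1+ s′ ] 2≤e e<d using (Z; Z-coprime; Z-valuation-bounded)
  open Orbit d e c 2≤e e<d using (A≡∣Z∣)
  open Growth d e (suc b′) (suc s′) 2≤e e<d (s≤s z≤n) (s≤s b′<s′) parity using (Z-growth)

  W : ℕ → ℕ
  W i = ∣ Z i ∣

  valuation-bounded : ∀ {p m} → Least (λ k → p ∣ W k) m → ∀ v n → p ℕ.^ v ∣ W n → p ℕ.^ v ∣ W m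
  valuation-bounded {p} {m} (p∣Wₘ , before) =
    Z-valuation-bounded (∣⇒coprimeˡ p∣Wₘ (Z-coprime (↥-↧ₙ-coprime c) m)) p∣Wₘ before

  𝒵-empty : ∀ n → ¬ InZ (poly d e c) n
  𝒵-empty zero    (() , _)
  𝒵-empty (suc i) (_ , no-primitive) = new-prime-divisor W 1<W₀ Z-growth valuation-bounded i earlier
    where
    1<W₀ : 1 < W 0
    1<W₀ = s≤s (ℕ.≤-trans (s≤s z≤n) b′<s′)
    earlier : ∀ p → Prime p → p ∣ W i → ∃[ m ] m < i × Least (λ k → p ∣ W k) m
    earlier p pp p∣Wᵢ with least-below (λ m → p ∣? W m) i
    ... | inj₂ found = found
    ... | inj₁ none  = contradiction (pp , subst (p ∣_) (sym (A≡∣Z∣ i)) p∣Wᵢ , not-before) (no-primitive p)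
      where
      not-before : ∀ m → 1 ≤ m → m < suc i → ¬ p ∣ A (poly d e c) m
      not-before (suc m) _ (s≤s m<i) = none m<i ∘ subst (p ∣_) (A≡∣Z∣ m)

proposition5p4 : (d e : ℕ) (c : ℚ) → 2 ≤ e → e < d →
    - (1ℚ +ℚ 1ℚ) <ℚ c → c <ℚ - 1ℚ →
    (¬ (2 ∣ d)) ⊎ (2 ∣ e) →
    ∀ n → ¬ InZ (poly d e c) n
proposition5p4 d e (mkℚ a b′ a⊥b) 2≤e e<d _ (*<* a*1<-1*b) parity =
  negative-numerator a a⊥b (subst₂ ℤ._<_ (ℤ.*-identityʳ a) (ℤ.-1*i≡-i (+ suc b′)) a*1<-1*b)
  where
  negative-numerator : ∀ a .(a⊥b : Coprime ∣ a ∣ (suc b′)) → a ℤ.< -[1+ b′ ] →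
                       ∀ n → ¬ InZ (poly d e (mkℚ a b′ a⊥b)) n
  negative-numerator (+ _)     _   ()
  negative-numerator -[1+ s′ ] a⊥b (ℤ.-<- b′<s′) = ZsigmondySet.𝒵-empty d e b′ s′ 2≤e e<d b′<s′ a⊥b parity
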